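{- Let $k \ge 3$ and $n \ge 3k^2-4k+3$. Then every permutation $a\in S_n$ whose first $2k-2$ letters are $1,2,\dots,2k-2$ (in this order) can be transformed, by an even number of pattern-replacements of the $\{12\cdots k,\ k\cdots 21\}$-equivalence, into either $12\cdots n$ or $2134\cdots n$.
   Context: $S_n$ is the set of permutations of $\{1,\dots,n\}$ written as words. A pattern-replacement under the $\{12\cdots k, k\cdots 21\}$-equivalence takes $k$ letters of a permutation, at arbitrary (not necessarily adjacent) positions, that are in increasing (resp. decreasing) order and rearranges them within those positions into decreasing (resp. increasing) order. -}

module Defs where

open import Data.Nat using (ℕ; zero; suc; _<_; _*_)
open import Data.Fin using (Fin; toℕ; opposite) renaming (_<_ to _<ᶠ_)
open import Data.Vec using (Vec; lookup; tabulate; toList)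
open import Data.List.Relation.Binary.Permutation.Propositional using (_↭_)
open import Data.Product using (Σ; ∃; _×_; _,_)
open import Data.Sum using (_⊎_)
open import Relation.Binary.PropositionalEquality using (_≡_)
open import Relation.Nullary using (¬_)

-- Words of length n over ℕ; a permutation in S_n is a word that is a
-- rearrangement of 1 2 ... n.
Word : ℕ → Set
Word n = Vec ℕ n

idWord : (n : ℕ) → Word n
idWord n = tabulate (λ i → suc (toℕ i))

-- the word 2 1 3 4 ... n (letter at 0-based position m)
swapLetter : ℕ → ℕ
swapLetter zero = 2
swapLetter (suc zero) = 1
swapLetter (suc (suc m)) = suc (suc (suc m))

word2134 : (n : ℕ) → Word n
word2134 n = tabulate (λ i → swapLetter (toℕ i))

IsPerm : {n : ℕ} → Word n → Set
IsPerm {n} w = toList w ↭ toList (idWord n)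

StrictlyIncreasingPos : {k n : ℕ} → (Fin k → Fin n) → Set
StrictlyIncreasingPos {k} p = ∀ (i j : Fin k) → i <ᶠ j → p i <ᶠ p j

IncreasingAt : {k n : ℕ} → Word n → (Fin k → Fin n) → Set
IncreasingAt {k} w p = ∀ (i j : Fin k) → i <ᶠ j → lookup w (p i) < lookup w (p j)

DecreasingAt : {k n : ℕ} → Word n → (Fin k → Fin n) → Set
DecreasingAt {k} w p = ∀ (i j : Fin k) → i <ᶠ j → lookup w (p j) < lookup w (p i)

Replace : (k : ℕ) {n : ℕ} → Word n → Word n → Set
Replace k {n} w w′ =
  Σ (Fin k → Fin n) λ p →
    StrictlyIncreasingPos p ×
    (IncreasingAt w p ⊎ DecreasingAt w p) ×
    (∀ (j : Fin k) → lookup w′ (p j) ≡ lookup w (p (opposite j))) ×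
    (∀ (m : Fin n) → (∀ (j : Fin k) → ¬ (p j ≡ m)) → lookup w′ m ≡ lookup w m)

data ReplaceSteps (k : ℕ) {n : ℕ} : ℕ → Word n → Word n → Set where
  done : ∀ {w} → ReplaceSteps k zero w w
  step : ∀ {t u v w} → Replace k u v → ReplaceSteps k t v w → ReplaceSteps k (suc t) u w

EvenReach : (k : ℕ) {n : ℕ} → Word n → Word n → Set
EvenReach k w w′ = ∃ λ m → ReplaceSteps k (2 * m) w w′

-- Write k = L + 2 and P = 2k − 2, and split the sorted prefix 1 2 ⋯ P (positions
-- counted from 0) into the positions 0, 1 and the blocks B₁ = [2, 2 + L) and
-- B₂ = [2 + L, P). If p ≠ q are positions ≥ P carrying letters larger than P, then
-- the k-letter patterns (0, B₁, p), (1, B₂, q), (0, B₁, q), (1, B₂, p), taken in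
-- this order, are increasing, increasing, decreasing, decreasing, and reversing
-- them one after the other exchanges the letters at p and q and the letters at 0
-- and 1 while restoring both blocks. Placing the letters n, n − 1, …, P + 1 by such
-- transpositions reaches 12⋯n or 2134⋯n after a multiple of four replacements.

module Submission where

open import Defs
open import Data.Nat using (ℕ; zero; suc; _+_; _*_; _∸_; _≤_; _<_; z≤n; s≤s; _≟_; _<?_; _≤?_)
open import Data.Nat.Properties
open import Data.Fin using (Fin; toℕ; fromℕ<; opposite)
open import Data.Fin.Properties using (toℕ-fromℕ<; fromℕ<-toℕ; toℕ<n; toℕ-injective; opposite-prop)
open import Data.Vec using (Vec; []; _∷_; lookup; tabulate; toList)
open import Data.Vec.Properties using (lookup∘tabulate; tabulate∘lookup; tabulate-cong)
open import Data.Sum as Sum using (_⊎_; inj₁; inj₂)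
open import Data.Product using (∃-syntax; _×_; _,_; proj₁; proj₂)
open import Relation.Nullary using (¬_; yes; no; contradiction)
open import Data.Vec.Membership.Propositional using (_∈_)
open import Data.Vec.Membership.Propositional.Properties using (∈-lookup; ∈-tabulate⁺; ∈-toList⁺; ∈-toList⁻)
import Data.Vec.Relation.Unary.Any as Any
open import Data.Vec.Relation.Unary.Any.Properties using (lookup-index)
import Data.Vec.Relation.Unary.All.Properties as VAll
open import Data.Vec.Relation.Unary.AllPairs using ([]; _∷_)
import Data.Vec.Relation.Unary.Unique.Propositional as VUnique
open import Data.Vec.Relation.Unary.Unique.Propositional.Properties using (tabulate⁺; lookup-injective)
open import Data.List.Relation.Unary.AllPairs using ([]; _∷_)
import Data.List.Relation.Unary.Unique.Propositional as LUnique
open import Data.List.Relation.Binary.Permutation.Propositional using (↭-sym; ↭⇒↭ₛ)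
open import Data.List.Relation.Binary.Permutation.Propositional.Properties using (∈-resp-↭)
open import Relation.Binary.PropositionalEquality.Properties using (setoid)
open import Data.List.Relation.Binary.Permutation.Setoid.Properties (setoid ℕ) using (Unique-resp-↭)
open import Data.Nat.Solver using (module +-*-Solver)
open import Relation.Binary.PropositionalEquality using (_≡_; _≢_; refl; sym; trans; cong; subst; subst₂; ≢-sym; module ≡-Reasoning)

-- Out of range `at` returns the junk letter 0, so every statement about it
-- carries a bound on the position.
at : ∀ {n} → Word n → ℕ → ℕ
at {n} w x with x <? n
... | yes x<n = lookup w (fromℕ< x<n)
... | no _    = 0

at-fromℕ< : ∀ {n} (w : Word n) {x} (x<n : x < n) → at w x ≡ lookup w (fromℕ< x<n)
at-fromℕ< {n} w {x} x<n with x <? n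
... | yes _  = refl
... | no x≮n = contradiction x<n x≮n

at-toℕ : ∀ {n} (w : Word n) (i : Fin n) → at w (toℕ i) ≡ lookup w i
at-toℕ w i = trans (at-fromℕ< w (toℕ<n i)) (cong (lookup w) (fromℕ<-toℕ i (toℕ<n i)))

≡-tabulate : ∀ {n} (w : Word n) (f : ℕ → ℕ) → (∀ x → x < n → at w x ≡ f x) →
             w ≡ tabulate (λ i → f (toℕ i))
≡-tabulate w f w≗f = trans (sym (tabulate∘lookup w))
  (tabulate-cong (λ i → trans (sym (at-toℕ w i)) (w≗f (toℕ i) (toℕ<n i))))

relabel : ∀ {n} → (ℕ → ℕ) → Word n → Word n
relabel σ w = tabulate (λ i → at w (σ (toℕ i)))

lookup-relabel : ∀ {n} σ (w : Word n) i → lookup (relabel σ w) i ≡ at w (σ (toℕ i))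
lookup-relabel σ w i = lookup∘tabulate _ i

at-relabel : ∀ {n} σ (w : Word n) {x} → x < n → at (relabel σ w) x ≡ at w (σ x)
at-relabel σ w x<n = trans (at-fromℕ< (relabel σ w) x<n)
  (trans (lookup-relabel σ w (fromℕ< x<n)) (cong (λ y → at w (σ y)) (toℕ-fromℕ< x<n)))

idWord-unique : ∀ n → VUnique.Unique (idWord n)
idWord-unique n = tabulate⁺ (λ eq → toℕ-injective (suc-injective eq))

∈-idWord⁺ : ∀ {n v} → v < n → suc v ∈ idWord n
∈-idWord⁺ {n} v<n = subst (_∈ idWord n) (cong suc (toℕ-fromℕ< v<n)) (∈-tabulate⁺ (λ i → suc (toℕ i)) (fromℕ< v<n))

∈-idWord⁻ : ∀ {n u} → u ∈ idWord n → ∃[ v ] v < n × u ≡ suc v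
∈-idWord⁻ u∈ = toℕ (Any.index u∈) , toℕ<n _ , trans (lookup-index u∈) (lookup∘tabulate _ (Any.index u∈))

at-∈ : ∀ {n x} (w : Word n) → x < n → at w x ∈ w
at-∈ w x<n = subst (_∈ w) (sym (at-fromℕ< w x<n)) (∈-lookup (fromℕ< x<n) w)

∈-at : ∀ {n u} {w : Word n} → u ∈ w → ∃[ x ] x < n × at w x ≡ u
∈-at {w = w} u∈w = toℕ (Any.index u∈w) , toℕ<n _ , trans (at-toℕ w _) (sym (lookup-index u∈w))

Unique-toList⁺ : ∀ {n} {xs : Vec ℕ n} → VUnique.Unique xs → LUnique.Unique (toList xs)
Unique-toList⁺ []           = []
Unique-toList⁺ (x∉xs ∷ xs!) = VAll.toList⁺ x∉xs ∷ Unique-toList⁺ xs!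

Unique-toList⁻ : ∀ {n} {xs : Vec ℕ n} → LUnique.Unique (toList xs) → VUnique.Unique xs
Unique-toList⁻ {xs = []}    []           = []
Unique-toList⁻ {xs = _ ∷ _} (x∉xs ∷ xs!) = VAll.toList⁻ x∉xs ∷ Unique-toList⁻ xs!

module _ {n : ℕ} {a : Word n} (a-perm : IsPerm a) where

  letter-occurs : ∀ v → v < n → ∃[ x ] x < n × at a x ≡ suc v
  letter-occurs v v<n = ∈-at (∈-toList⁻ (∈-resp-↭ (↭-sym a-perm) (∈-toList⁺ (∈-idWord⁺ v<n))))

  letter-form : ∀ {x} → x < n → ∃[ v ] v < n × at a x ≡ suc v
  letter-form x<n = ∈-idWord⁻ (∈-toList⁻ (∈-resp-↭ a-perm (∈-toList⁺ (at-∈ a x<n))))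

  at-injective : ∀ {x y} → x < n → y < n → at a x ≡ at a y → x ≡ y
  at-injective {x} {y} x<n y<n ax≡ay = begin
    x                    ≡⟨ toℕ-fromℕ< x<n ⟨
    toℕ (fromℕ< x<n)     ≡⟨ cong toℕ (lookup-injective a-unique _ _ lookup≡) ⟩
    toℕ (fromℕ< y<n)     ≡⟨ toℕ-fromℕ< y<n ⟩
    y                    ∎
    where
    open ≡-Reasoning
    a-unique : VUnique.Unique a
    a-unique = Unique-toList⁻ (Unique-resp-↭ (↭⇒↭ₛ (↭-sym a-perm)) (Unique-toList⁺ (idWord-unique n)))
    lookup≡ : lookup a (fromℕ< x<n) ≡ lookup a (fromℕ< y<n)
    lookup≡ = trans (sym (at-fromℕ< a x<n)) (trans ax≡ay (at-fromℕ< a y<n))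

-- Reversing a pattern

mirror : ℕ → ℕ → ℕ
mirror L j = L ∸ suc j

mirror-< : ∀ {L j} → j < L → mirror L j < L
mirror-< {L} j<L = ∸-monoʳ-< {L} {suc _} {0} (s≤s z≤n) j<L

∸-mirror : ∀ {L j} → j < L → L ∸ j ≡ suc (mirror L j)
∸-mirror {suc L} {zero}  _         = refl
∸-mirror {suc L} {suc j} (s≤s j<L) = ∸-mirror j<L

mirror-involutive : ∀ {L j} → j < L → mirror L (mirror L j) ≡ j
mirror-involutive {L} j<L = trans (cong (L ∸_) (sym (∸-mirror j<L))) (m∸[m∸n]≡n (<⇒≤ j<L))

transpose : ℕ → ℕ → ℕ → ℕ
transpose a b x with x ≟ a | x ≟ b
... | yes _ | _     = b
... | no _  | yes _ = a
... | no _  | no _  = x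

transpose-ˡ : ∀ a b → transpose a b a ≡ b
transpose-ˡ a b with a ≟ a
... | yes _ = refl
... | no a≢a = contradiction refl a≢a

transpose-ʳ : ∀ a b → transpose a b b ≡ a
transpose-ʳ a b with b ≟ a | b ≟ b
... | yes refl | _ = refl
... | no _ | yes _ = refl
... | no _ | no b≢b = contradiction refl b≢b

transpose-other : ∀ a b {x} → x ≢ a → x ≢ b → transpose a b x ≡ x
transpose-other a b {x} x≢a x≢b with x ≟ a | x ≟ b
... | yes x≡a | _ = contradiction x≡a x≢a
... | no _ | yes x≡b = contradiction x≡b x≢b
... | no _ | no _ = refl

reverseBlock : ℕ → ℕ → ℕ → ℕ
reverseBlock b L x with b ≤? x | x <? b + L
... | yes _ | yes _ = b + mirror L (x ∸ b)
... | _     | _     = x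

reverseBlock-inside : ∀ b L {j} → j < L → reverseBlock b L (b + j) ≡ b + mirror L j
reverseBlock-inside b L {j} j<L with b ≤? b + j | b + j <? b + L
... | yes _ | yes _ = cong (λ t → b + mirror L t) (m+n∸m≡n b j)
... | no b≰b+j | _ = contradiction (m≤m+n b j) b≰b+j
... | yes _ | no b+j≮b+L = contradiction (+-monoʳ-< b j<L) b+j≮b+L

reverseBlock-outside : ∀ b L {x} → x < b ⊎ b + L ≤ x → reverseBlock b L x ≡ x
reverseBlock-outside b L {x} out with b ≤? x | x <? b + L
reverseBlock-outside b L (inj₁ x<b) | yes b≤x | yes _ = contradiction b≤x (<⇒≱ x<b)
reverseBlock-outside b L (inj₂ b+L≤x) | yes _ | yes x<b+L = contradiction b+L≤x (<⇒≱ x<b+L)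
... | yes _ | no _ = refl
... | no _  | _    = refl

patternPos : ℕ → ℕ → ℕ → ℕ → ℕ → ℕ
patternPos s b L s' zero = s
patternPos s b L s' (suc j) with j <? L
... | yes _ = b + j
... | no _  = s'

patternPos-block : ∀ s b L s' {j} → j < L → patternPos s b L s' (suc j) ≡ b + j
patternPos-block s b L s' {j} j<L with j <? L
... | yes _  = refl
... | no j≮L = contradiction j<L j≮L

patternPos-last : ∀ s b L s' → patternPos s b L s' (suc L) ≡ s'
patternPos-last s b L s' with L <? L
... | yes L<L = contradiction L<L (n≮n L)
... | no _    = refl

reversePattern : ℕ → ℕ → ℕ → ℕ → ℕ → ℕ
reversePattern s b L s' x = transpose s s' (reverseBlock b L x)

record Chain (R : ℕ → ℕ → Set) (s b L s' : ℕ) : Set where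
  constructor chain
  field
    first-block : ∀ j → j < L → R s (b + j)
    block-last  : ∀ j → j < L → R (b + j) s'
    block-block : ∀ i j → i < j → j < L → R (b + i) (b + j)
    first-last  : R s s'

chain-patternPos : ∀ {R s b L s'} → Chain R s b L s' →
  ∀ i j → i < j → j < 2 + L → R (patternPos s b L s' i) (patternPos s b L s' j)
chain-patternPos {L = L} (chain s-b b-s' b-b s-s') zero (suc j) _ _ with j <? L
... | yes j<L = s-b j j<L
... | no _    = s-s'
chain-patternPos {L = L} (chain s-b b-s' b-b s-s') (suc i) (suc j) (s≤s i<j) (s≤s j<1+L)
  with i <? L | j <? L
... | yes _   | yes j<L = b-b i j i<j j<L
... | yes i<L | no _    = b-s' i i<L
... | no i≮L  | yes j<L = contradiction (<-trans i<j j<L) i≮L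
... | no i≮L  | no _    = contradiction (<-≤-trans i<j (≤-pred j<1+L)) i≮L

Ascending Descending : ∀ {n} → Word n → ℕ → ℕ → ℕ → ℕ → Set
Ascending  w = Chain (λ x y → at w x < at w y)
Descending w = Chain (λ x y → at w y < at w x)

ascending-chain : ∀ (f : ℕ → ℕ) s b L s' c → f s < c → c + L ≤ f s' →
  (∀ j → j < L → f (b + j) ≡ c + j) → Chain (λ x y → f x < f y) s b L s'
ascending-chain f s b L s' c fs<c c+L≤fs' block = chain
    (λ j j<L → subst (f s <_) (sym (block j j<L)) (<-≤-trans fs<c (m≤m+n c j)))
    (λ j j<L → subst (_< f s') (sym (block j j<L)) (<-≤-trans (+-monoʳ-< c j<L) c+L≤fs'))
    (λ i j i<j j<L → subst₂ _<_ (sym (block i (<-trans i<j j<L))) (sym (block j j<L))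
                       (+-monoʳ-< c i<j))
    (<-≤-trans fs<c (≤-trans (m≤m+n c L) c+L≤fs'))

descending-chain : ∀ (f : ℕ → ℕ) s b L s' c → f s' < c → c + L ≤ f s →
  (∀ j → j < L → f (b + j) ≡ c + mirror L j) → Chain (λ x y → f y < f x) s b L s'
descending-chain f s b L s' c fs'<c c+L≤fs block = chain
    (λ j j<L → subst (_< f s) (sym (block j j<L)) (<-≤-trans (+-monoʳ-< c (mirror-< j<L)) c+L≤fs))
    (λ j j<L → subst (f s' <_) (sym (block j j<L)) (<-≤-trans fs'<c (m≤m+n c _)))
    (λ i j i<j j<L → subst₂ _<_ (sym (block j j<L)) (sym (block i (<-trans i<j j<L)))
                       (+-monoʳ-< c (∸-monoʳ-< {L} (s≤s i<j) j<L)))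
    (<-≤-trans fs'<c (≤-trans (m≤m+n c L) c+L≤fs))

module Pattern (s b L s' : ℕ) (s<b : s < b) (b+L≤s' : b + L ≤ s') where

  private
    pos : ℕ → ℕ
    pos = patternPos s b L s'

    σ : ℕ → ℕ
    σ = reversePattern s b L s'

  s<block : ∀ j → s < b + j
  s<block j = <-≤-trans s<b (m≤m+n b j)

  block<s' : ∀ {j} → j < L → b + j < s'
  block<s' j<L = <-≤-trans (+-monoʳ-< b j<L) b+L≤s'

  s<s' : s < s'
  s<s' = <-≤-trans s<b (≤-trans (m≤m+n b L) b+L≤s')

  positions-ascending : Chain _<_ s b L s'
  positions-ascending = chain (λ j _ → s<block j) (λ _ → block<s') (λ i j i<j _ → +-monoʳ-< b i<j) s<s'

  patternPos-≤ : ∀ j → pos j ≤ s'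
  patternPos-≤ zero = <⇒≤ s<s'
  patternPos-≤ (suc j) with j <? L
  ... | yes j<L = <⇒≤ (block<s' j<L)
  ... | no _    = ≤-refl

  reversePattern-s : σ s ≡ s'
  reversePattern-s = trans (cong (transpose s s') (reverseBlock-outside b L (inj₁ s<b))) (transpose-ˡ s s')

  reversePattern-s' : σ s' ≡ s
  reversePattern-s' = trans (cong (transpose s s') (reverseBlock-outside b L (inj₂ b+L≤s'))) (transpose-ʳ s s')

  reversePattern-block : ∀ {j} → j < L → σ (b + j) ≡ b + mirror L j
  reversePattern-block j<L = trans (cong (transpose s s') (reverseBlock-inside b L j<L))
    (transpose-other s s' (>⇒≢ (s<block _)) (<⇒≢ (block<s' (mirror-< j<L))))

  reversePattern-outside : ∀ {x} → x ≢ s → x ≢ s' → x < b ⊎ b + L ≤ x → σ x ≡ x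
  reversePattern-outside x≢s x≢s' out =
    trans (cong (transpose s s') (reverseBlock-outside b L out)) (transpose-other s s' x≢s x≢s')

  reversePattern-patternPos : ∀ j → j < 2 + L → σ (pos j) ≡ pos (suc L ∸ j)
  reversePattern-patternPos zero _ = trans reversePattern-s (sym (patternPos-last s b L s'))
  reversePattern-patternPos (suc j) (s≤s j<1+L) with j <? L
  ... | yes j<L = begin
    σ (b + j)                   ≡⟨ reversePattern-block j<L ⟩
    b + mirror L j              ≡⟨ patternPos-block s b L s' (mirror-< j<L) ⟨
    pos (suc (mirror L j))      ≡⟨ cong pos (∸-mirror j<L) ⟨
    pos (L ∸ j)                 ∎
    where open ≡-Reasoning
  ... | no j≮L with ≤-antisym (≤-pred j<1+L) (≮⇒≥ j≮L)
  ...   | refl = trans reversePattern-s' (cong pos (sym (n∸n≡0 j)))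

  reversePattern-fixes : ∀ x → (∀ j → j < 2 + L → pos j ≢ x) → σ x ≡ x
  reversePattern-fixes x not-pos = reversePattern-outside
    (λ x≡s → not-pos 0 (s≤s z≤n) (sym x≡s))
    (λ x≡s' → not-pos (suc L) ≤-refl (trans (patternPos-last s b L s') (sym x≡s')))
    outside
    where
    outside : x < b ⊎ b + L ≤ x
    outside with x <? b | b + L ≤? x
    ... | yes x<b | _        = inj₁ x<b
    ... | no _    | yes b+L≤x = inj₂ b+L≤x
    ... | no x≮b  | no b+L≰x = contradiction
          (trans (patternPos-block s b L s' j<L) (m+[n∸m]≡n b≤x))
          (not-pos (suc (x ∸ b)) (s≤s (m≤n⇒m≤1+n j<L)))
      where
      b≤x : b ≤ x
      b≤x = ≮⇒≥ x≮b
      j<L : x ∸ b < L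
      j<L = +-cancelˡ-< b (x ∸ b) L (subst (_< b + L) (sym (m+[n∸m]≡n b≤x)) (≰⇒> b+L≰x))

  module _ {n} (w : Word n) (s'<n : s' < n) where

    pos<n : ∀ j → pos j < n
    pos<n j = ≤-<-trans (patternPos-≤ j) s'<n

    posFin : Fin (2 + L) → Fin n
    posFin i = fromℕ< (pos<n (toℕ i))

    toℕ-posFin : ∀ i → toℕ (posFin i) ≡ pos (toℕ i)
    toℕ-posFin i = toℕ-fromℕ< (pos<n (toℕ i))

    lookup-posFin : ∀ i → lookup w (posFin i) ≡ at w (pos (toℕ i))
    lookup-posFin i = sym (at-fromℕ< w (pos<n (toℕ i)))

    reversePattern-replace : Ascending w s b L s' ⊎ Descending w s b L s' → Replace (2 + L) w (relabel σ w)
    reversePattern-replace monotone = posFin , ascendingPositions , monotoneLetters monotone , reversed , unchanged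
      where
      ascendingPositions : StrictlyIncreasingPos posFin
      ascendingPositions i j i<j = subst₂ _<_ (sym (toℕ-posFin i)) (sym (toℕ-posFin j))
        (chain-patternPos positions-ascending (toℕ i) (toℕ j) i<j (toℕ<n j))

      monotoneLetters : Ascending w s b L s' ⊎ Descending w s b L s' → IncreasingAt w posFin ⊎ DecreasingAt w posFin
      monotoneLetters (inj₁ up) = inj₁ λ i j i<j →
        subst₂ _<_ (sym (lookup-posFin i)) (sym (lookup-posFin j)) (chain-patternPos up (toℕ i) (toℕ j) i<j (toℕ<n j))
      monotoneLetters (inj₂ down) = inj₂ λ i j i<j →
        subst₂ _<_ (sym (lookup-posFin j)) (sym (lookup-posFin i)) (chain-patternPos down (toℕ i) (toℕ j) i<j (toℕ<n j))

      reversed : ∀ j → lookup (relabel σ w) (posFin j) ≡ lookup w (posFin (opposite j))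
      reversed j = begin
        lookup (relabel σ w) (posFin j)     ≡⟨ lookup-relabel σ w (posFin j) ⟩
        at w (σ (toℕ (posFin j)))           ≡⟨ cong (λ t → at w (σ t)) (toℕ-posFin j) ⟩
        at w (σ (pos (toℕ j)))              ≡⟨ cong (at w) (reversePattern-patternPos (toℕ j) (toℕ<n j)) ⟩
        at w (pos (suc L ∸ toℕ j))          ≡⟨ cong (λ t → at w (pos t)) (opposite-prop j) ⟨
        at w (pos (toℕ (opposite j)))       ≡⟨ lookup-posFin (opposite j) ⟨
        lookup w (posFin (opposite j))      ∎
        where open ≡-Reasoning

      unchanged : ∀ m → (∀ j → ¬ (posFin j ≡ m)) → lookup (relabel σ w) m ≡ lookup w m
      unchanged m not-pos = begin
        lookup (relabel σ w) m   ≡⟨ lookup-relabel σ w m ⟩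
        at w (σ (toℕ m))         ≡⟨ cong (at w) (reversePattern-fixes (toℕ m) not-posℕ) ⟩
        at w (toℕ m)             ≡⟨ at-toℕ w m ⟩
        lookup w m               ∎
        where
        open ≡-Reasoning
        not-posℕ : ∀ j → j < 2 + L → pos j ≢ toℕ m
        not-posℕ j j<2+L pos≡m = not-pos (fromℕ< j<2+L) (toℕ-injective (begin
          toℕ (posFin (fromℕ< j<2+L))  ≡⟨ toℕ-posFin (fromℕ< j<2+L) ⟩
          pos (toℕ (fromℕ< j<2+L))     ≡⟨ cong pos (toℕ-fromℕ< j<2+L) ⟩
          pos j                        ≡⟨ pos≡m ⟩
          toℕ m                        ∎))

-- Transposing two letters by four reversals

module Gadget {n : ℕ} (L : ℕ) where

  P : ℕ
  P = 2 + L + L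

  2+L≤P : 2 + L ≤ P
  2+L≤P = m≤m+n (2 + L) L

  block₁<P : ∀ {j} → j < L → 2 + j < P
  block₁<P j<L = <-≤-trans (+-monoʳ-< 2 j<L) 2+L≤P

  block₂<P : ∀ {j} → j < L → 2 + L + j < P
  block₂<P j<L = +-monoʳ-< (2 + L) j<L

  <P⇒≢ : ∀ {x r} → x < P → P ≤ r → x ≢ r
  <P⇒≢ x<P P≤r = <⇒≢ (<-≤-trans x<P P≤r)

  <P⇒<n : ∀ {x r} → x < P → P ≤ r → r < n → x < n
  <P⇒<n x<P P≤r r<n = <-trans (<-≤-trans x<P P≤r) r<n

  module Reverse₁ (u : Word n) (r : ℕ) (P≤r : P ≤ r) (r<n : r < n) where
    open Pattern 0 2 L r (s≤s z≤n) (≤-trans 2+L≤P P≤r)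

    u′ : Word n
    u′ = relabel (reversePattern 0 2 L r) u

    private
      moved : ∀ {x} → x < n → at u′ x ≡ at u (reversePattern 0 2 L r x)
      moved = at-relabel (reversePattern 0 2 L r) u

      <n : ∀ {x} → x < P → x < n
      <n x<P = <P⇒<n x<P P≤r r<n

    at-0 : at u′ 0 ≡ at u r
    at-0 = trans (moved (<n (s≤s z≤n))) (cong (at u) reversePattern-s)

    at-r : at u′ r ≡ at u 0
    at-r = trans (moved r<n) (cong (at u) reversePattern-s')

    at-block₁ : ∀ {j} → j < L → at u′ (2 + j) ≡ at u (2 + mirror L j)
    at-block₁ j<L = trans (moved (<n (block₁<P j<L))) (cong (at u) (reversePattern-block j<L))

    at-1 : at u′ 1 ≡ at u 1
    at-1 = trans (moved (<n (s≤s (s≤s z≤n))))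
      (cong (at u) (reversePattern-outside (λ ()) (<P⇒≢ (s≤s (s≤s z≤n)) P≤r) (inj₁ (s≤s (s≤s z≤n)))))

    at-block₂ : ∀ {j} → j < L → at u′ (2 + L + j) ≡ at u (2 + L + j)
    at-block₂ {j} j<L = trans (moved (<n (block₂<P j<L)))
      (cong (at u) (reversePattern-outside (λ ()) (<P⇒≢ (block₂<P j<L) P≤r) (inj₂ (m≤m+n (2 + L) j))))

    at-far : ∀ {x} → x < n → P ≤ x → x ≢ r → at u′ x ≡ at u x
    at-far x<n P≤x x≢r = trans (moved x<n)
      (cong (at u) (reversePattern-outside (>⇒≢ (<-≤-trans (s≤s z≤n) P≤x)) x≢r (inj₂ (≤-trans 2+L≤P P≤x))))

    replace : Ascending u 0 2 L r ⊎ Descending u 0 2 L r → Replace (2 + L) u u′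
    replace = reversePattern-replace u r<n

  module Reverse₂ (u : Word n) (r : ℕ) (P≤r : P ≤ r) (r<n : r < n) where
    open Pattern 1 (2 + L) L r (s≤s (s≤s z≤n)) P≤r

    u′ : Word n
    u′ = relabel (reversePattern 1 (2 + L) L r) u

    private
      moved : ∀ {x} → x < n → at u′ x ≡ at u (reversePattern 1 (2 + L) L r x)
      moved = at-relabel (reversePattern 1 (2 + L) L r) u

      <n : ∀ {x} → x < P → x < n
      <n x<P = <P⇒<n x<P P≤r r<n

    at-1 : at u′ 1 ≡ at u r
    at-1 = trans (moved (<n (s≤s (s≤s z≤n)))) (cong (at u) reversePattern-s)

    at-r : at u′ r ≡ at u 1
    at-r = trans (moved r<n) (cong (at u) reversePattern-s')

    at-block₂ : ∀ {j} → j < L → at u′ (2 + L + j) ≡ at u (2 + L + mirror L j)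
    at-block₂ j<L = trans (moved (<n (block₂<P j<L))) (cong (at u) (reversePattern-block j<L))

    at-0 : at u′ 0 ≡ at u 0
    at-0 = trans (moved (<n (s≤s z≤n)))
      (cong (at u) (reversePattern-outside (λ ()) (<P⇒≢ (s≤s z≤n) P≤r) (inj₁ (s≤s z≤n))))

    at-block₁ : ∀ {j} → j < L → at u′ (2 + j) ≡ at u (2 + j)
    at-block₁ j<L = trans (moved (<n (block₁<P j<L)))
      (cong (at u) (reversePattern-outside (λ ()) (<P⇒≢ (block₁<P j<L) P≤r) (inj₁ (+-monoʳ-< 2 j<L))))

    at-far : ∀ {x} → x < n → P ≤ x → x ≢ r → at u′ x ≡ at u x
    at-far x<n P≤x x≢r = trans (moved x<n)
      (cong (at u) (reversePattern-outside (>⇒≢ (<-≤-trans (s≤s (s≤s z≤n)) P≤x)) x≢r (inj₂ P≤x)))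

    replace : Ascending u 1 (2 + L) L r ⊎ Descending u 1 (2 + L) L r → Replace (2 + L) u u′
    replace = reversePattern-replace u r<n

  prefix-cases : ∀ {x} → 2 ≤ x → x < P → (∃[ j ] j < L × x ≡ 2 + j) ⊎ (∃[ j ] j < L × x ≡ 2 + L + j)
  prefix-cases {suc (suc y)} (s≤s (s≤s _)) (s≤s (s≤s y<L+L)) with y <? L
  ... | yes y<L = inj₁ (y , y<L , refl)
  ... | no y≮L  = inj₂ (y ∸ L , y∸L<L , cong (2 +_) (sym (m+[n∸m]≡n L≤y)))
    where
    L≤y : L ≤ y
    L≤y = ≮⇒≥ y≮L
    y∸L<L : y ∸ L < L
    y∸L<L = +-cancelˡ-< L (y ∸ L) L (subst (_< L + L) (sym (m+[n∸m]≡n L≤y)) y<L+L)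

  module Transposition (w : Word n) (p q : ℕ) (P≤p : P ≤ p) (P≤q : P ≤ q) (p≢q : p ≢ q)
    (p<n : p < n) (q<n : q < n) (w₀<3 : at w 0 < 3) (w₁<3 : at w 1 < 3)
    (prefix : ∀ x → 2 ≤ x → x < P → at w x ≡ suc x) (P<wp : P < at w p) (P<wq : P < at w q) where

    private
      module M₁ = Reverse₁ w p P≤p p<n
      module M₂ = Reverse₂ M₁.u′ q P≤q q<n
      module M₃ = Reverse₁ M₂.u′ q P≤q q<n
      module M₄ = Reverse₂ M₃.u′ p P≤p p<n

    w′ : Word n
    w′ = M₄.u′

    private
      block₁ : ∀ j → j < L → at w (2 + j) ≡ 3 + j
      block₁ j j<L = prefix (2 + j) (m≤m+n 2 j) (block₁<P j<L)

      block₂ : ∀ j → j < L → at w (2 + L + j) ≡ 3 + L + j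
      block₂ j j<L = prefix (2 + L + j) (≤-trans (m≤m+n 2 L) (m≤m+n (2 + L) j)) (block₂<P j<L)

      3+L≤wp : 3 + L ≤ at w p
      3+L≤wp = ≤-trans (s≤s 2+L≤P) P<wp

      <3+L : ∀ {x} → x < 3 → x < 3 + L
      <3+L x<3 = <-≤-trans x<3 (m≤m+n 3 L)

    steps : ReplaceSteps (2 + L) 4 w w′
    steps = step {v = M₁.u′} (M₁.replace (inj₁ up₁)) (step {v = M₂.u′} (M₂.replace (inj₁ up₂))
              (step {v = M₃.u′} (M₃.replace (inj₂ down₃)) (step {v = w′} (M₄.replace (inj₂ down₄)) done)))
      where
      up₁ : Ascending w 0 2 L p
      up₁ = ascending-chain (at w) 0 2 L p 3 w₀<3 3+L≤wp block₁

      up₂ : Ascending M₁.u′ 1 (2 + L) L q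
      up₂ = ascending-chain (at M₁.u′) 1 (2 + L) L q (3 + L)
        (subst (_< 3 + L) (sym M₁.at-1) (<3+L w₁<3))
        (subst (3 + L + L ≤_) (sym (M₁.at-far q<n P≤q (≢-sym p≢q))) P<wq)
        (λ j j<L → trans (M₁.at-block₂ j<L) (block₂ j j<L))

      down₃ : Descending M₂.u′ 0 2 L q
      down₃ = descending-chain (at M₂.u′) 0 2 L q 3
        (subst (_< 3) (sym (trans M₂.at-r M₁.at-1)) w₁<3)
        (subst (3 + L ≤_) (sym (trans M₂.at-0 M₁.at-0)) 3+L≤wp)
        (λ j j<L → trans (M₂.at-block₁ j<L) (trans (M₁.at-block₁ j<L) (block₁ _ (mirror-< j<L))))

      down₄ : Descending M₃.u′ 1 (2 + L) L p
      down₄ = descending-chain (at M₃.u′) 1 (2 + L) L p (3 + L)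
        (subst (_< 3 + L) (sym (trans (M₃.at-far p<n P≤p p≢q) (trans (M₂.at-far p<n P≤p p≢q) M₁.at-r)))
          (<3+L w₀<3))
        (subst (3 + L + L ≤_) (sym (trans M₃.at-1 (trans M₂.at-1 (M₁.at-far q<n P≤q (≢-sym p≢q))))) P<wq)
        (λ j j<L → trans (M₃.at-block₂ j<L) (trans (M₂.at-block₂ j<L)
          (trans (M₁.at-block₂ (mirror-< j<L)) (block₂ _ (mirror-< j<L)))))

    at-0 : at w′ 0 ≡ at w 1
    at-0 = trans M₄.at-0 (trans M₃.at-0 (trans M₂.at-r M₁.at-1))

    at-1 : at w′ 1 ≡ at w 0
    at-1 = trans M₄.at-1 (trans (M₃.at-far p<n P≤p p≢q) (trans (M₂.at-far p<n P≤p p≢q) M₁.at-r))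

    at-p : at w′ p ≡ at w q
    at-p = trans M₄.at-r (trans M₃.at-1 (trans M₂.at-1 (M₁.at-far q<n P≤q (≢-sym p≢q))))

    at-q : at w′ q ≡ at w p
    at-q = trans (M₄.at-far q<n P≤q (≢-sym p≢q)) (trans M₃.at-r (trans M₂.at-0 M₁.at-0))

    at-far : ∀ {x} → x < n → P ≤ x → x ≢ p → x ≢ q → at w′ x ≡ at w x
    at-far x<n P≤x x≢p x≢q = trans (M₄.at-far x<n P≤x x≢p)
      (trans (M₃.at-far x<n P≤x x≢q) (trans (M₂.at-far x<n P≤x x≢q) (M₁.at-far x<n P≤x x≢p)))

    at-prefix : ∀ x → 2 ≤ x → x < P → at w′ x ≡ at w x
    at-prefix x 2≤x x<P with prefix-cases 2≤x x<P
    ... | inj₁ (j , j<L , refl) = begin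
      at w′ (2 + j)                      ≡⟨ M₄.at-block₁ j<L ⟩
      at M₃.u′ (2 + j)                   ≡⟨ M₃.at-block₁ j<L ⟩
      at M₂.u′ (2 + mirror L j)          ≡⟨ M₂.at-block₁ (mirror-< j<L) ⟩
      at M₁.u′ (2 + mirror L j)          ≡⟨ M₁.at-block₁ (mirror-< j<L) ⟩
      at w (2 + mirror L (mirror L j))   ≡⟨ cong (λ t → at w (2 + t)) (mirror-involutive j<L) ⟩
      at w (2 + j)                       ∎
      where open ≡-Reasoning
    ... | inj₂ (j , j<L , refl) = begin
      at w′ (2 + L + j)                        ≡⟨ M₄.at-block₂ j<L ⟩
      at M₃.u′ (2 + L + mirror L j)            ≡⟨ M₃.at-block₂ (mirror-< j<L) ⟩
      at M₂.u′ (2 + L + mirror L j)            ≡⟨ M₂.at-block₂ (mirror-< j<L) ⟩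
      at M₁.u′ (2 + L + mirror L (mirror L j)) ≡⟨ cong (λ t → at M₁.u′ (2 + L + t)) (mirror-involutive j<L) ⟩
      at M₁.u′ (2 + L + j)                     ≡⟨ M₁.at-block₂ j<L ⟩
      at w (2 + L + j)                         ∎
      where open ≡-Reasoning

    preimage : ∀ y → y < n → ∃[ y′ ] y′ < n × at w′ y′ ≡ at w y
    preimage zero _ = 1 , <P⇒<n (s≤s (s≤s z≤n)) P≤p p<n , at-1
    preimage (suc zero) _ = 0 , <P⇒<n (s≤s z≤n) P≤p p<n , at-0
    preimage y@(suc (suc _)) y<n with y ≟ p | y ≟ q | y <? P
    ... | yes refl | _        | _       = q , q<n , at-q
    ... | no _     | yes refl | _       = p , p<n , at-p
    ... | no _     | no _     | yes y<P = y , y<n , at-prefix y (s≤s (s≤s z≤n)) y<P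
    ... | no y≢p   | no y≢q   | no y≮P  = y , y<n , at-far y<n (≮⇒≥ y≮P) y≢p y≢q

-- Sorting from the right

steps-++ : ∀ {k n s t} {u v w : Word n} →
           ReplaceSteps k s u v → ReplaceSteps k t v w → ReplaceSteps k (s + t) u w
steps-++ done       r′ = r′
steps-++ (step x r) r′ = step x (steps-++ r r′)

evenReach-prepend : ∀ {k n} {u v w : Word n} → ReplaceSteps k 4 u v → EvenReach k v w → EvenReach k u w
evenReach-prepend {k} {u = u} {w = w} r (m , r′) =
  2 + m , subst (λ t → ReplaceSteps k t u w) (sym (*-distribˡ-+ 2 2 m)) (steps-++ r r′)

module Sorting {n : ℕ} (L : ℕ) where
  open Gadget {n} L

  Goal : Word n → Set
  Goal w = EvenReach (2 + L) w (idWord n) ⊎ EvenReach (2 + L) w (word2134 n)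

  Head : Word n → Set
  Head w = (at w 0 ≡ 1 × at w 1 ≡ 2) ⊎ (at w 0 ≡ 2 × at w 1 ≡ 1)

  head-swap : ∀ {w w′} → at w′ 0 ≡ at w 1 → at w′ 1 ≡ at w 0 → Head w → Head w′
  head-swap w′₀ w′₁ (inj₁ (w₀ , w₁)) = inj₂ (trans w′₀ w₁ , trans w′₁ w₀)
  head-swap w′₀ w′₁ (inj₂ (w₀ , w₁)) = inj₁ (trans w′₀ w₁ , trans w′₁ w₀)

  head-≤2 : ∀ {w} → Head w → at w 0 ≤ 2 × at w 1 ≤ 2
  head-≤2 (inj₁ (w₀ , w₁)) = subst (_≤ 2) (sym w₀) (s≤s z≤n) , subst (_≤ 2) (sym w₁) ≤-refl
  head-≤2 (inj₂ (w₀ , w₁)) = subst (_≤ 2) (sym w₀) ≤-refl , subst (_≤ 2) (sym w₁) (s≤s z≤n)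

  -- Besides agreeing with 12⋯n or 2134⋯n on the first P and the last n − m
  -- positions, `onto` and `large` keep what is needed of w being a permutation.
  record Invariant (m : ℕ) (w : Word n) : Set where
    field
      head   : Head w
      prefix : ∀ x → 2 ≤ x → x < P → at w x ≡ suc x
      suffix : ∀ x → m ≤ x → x < n → at w x ≡ suc x
      onto   : ∀ v → v < n → ∃[ x ] x < n × at w x ≡ suc v
      large  : ∀ x → P ≤ x → x < n → P < at w x

  prefix-≤ : ∀ {m w x} → Invariant m w → x < P → at w x ≤ P
  prefix-≤ {x = zero}        inv _   = ≤-trans (proj₁ (head-≤2 (Invariant.head inv))) (s≤s (s≤s z≤n))
  prefix-≤ {x = suc zero}    inv _   = ≤-trans (proj₂ (head-≤2 (Invariant.head inv))) (s≤s (s≤s z≤n))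
  prefix-≤ {x = suc (suc x)} inv x<P = subst (_≤ P) (sym (Invariant.prefix inv _ (s≤s (s≤s z≤n)) x<P)) x<P

  goal-of-sorted : ∀ {w} → Invariant P w → Goal w
  goal-of-sorted {w} inv = Sum.map (reached suc (λ _ → refl)) (reached swapLetter (λ _ → refl)) head
    where
    open Invariant inv
    reached : (f : ℕ → ℕ) → (∀ y → f (2 + y) ≡ 3 + y) → at w 0 ≡ f 0 × at w 1 ≡ f 1 →
              EvenReach (2 + L) w (tabulate (λ i → f (toℕ i)))
    reached f f-tail (w₀ , w₁) = 0 , subst (ReplaceSteps (2 + L) 0 w) (≡-tabulate w f agrees) done
      where
      agrees : ∀ x → x < n → at w x ≡ f x
      agrees zero             _   = w₀
      agrees (suc zero)       _   = w₁
      agrees x@(suc (suc y)) x<n with x <? P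
      ... | yes x<P = trans (prefix x (s≤s (s≤s z≤n)) x<P) (sym (f-tail y))
      ... | no x≮P  = trans (suffix x (≮⇒≥ x≮P) x<n) (sym (f-tail y))

  letter-position : ∀ {m w x} → Invariant (suc m) w → P ≤ m → x < n → at w x ≡ suc m → P ≤ x × x ≤ m
  letter-position {m} {w} {x} inv P≤m x<n wx≡1+m = P≤x , x≤m
    where
    open Invariant inv
    P≤x : P ≤ x
    P≤x = ≮⇒≥ λ x<P → <⇒≱ (s≤s P≤m) (subst (_≤ P) wx≡1+m (prefix-≤ inv x<P))
    x≤m : x ≤ m
    x≤m = ≮⇒≥ λ m<x → <⇒≢ m<x (suc-injective (trans (sym wx≡1+m) (suffix x m<x x<n)))

  invariant-shrink : ∀ {m w} → Invariant (suc m) w → at w m ≡ suc m → Invariant m w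
  invariant-shrink {m} {w} inv wm≡1+m = record { Invariant inv; suffix = suffix′ }
    where
    suffix′ : ∀ y → m ≤ y → y < n → at w y ≡ suc y
    suffix′ y m≤y y<n with y ≟ m
    ... | yes refl = wm≡1+m
    ... | no y≢m   = Invariant.suffix inv y (≤∧≢⇒< m≤y (≢-sym y≢m)) y<n

  invariant-transpose : ∀ {m w x} → Invariant (suc m) w → P ≤ x → x < m → m < n → at w x ≡ suc m →
                        ∃[ w′ ] ReplaceSteps (2 + L) 4 w w′ × Invariant m w′
  invariant-transpose {m} {w} {x} inv P≤x x<m m<n wx≡1+m =
    T.w′ , T.steps , record { head = head′ ; prefix = prefix′ ; suffix = suffix′ ; onto = onto′ ; large = large′ }
    where
    open Invariant inv
    P≤m : P ≤ m
    P≤m = ≤-trans P≤x (<⇒≤ x<m)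
    P<wx : P < at w x
    P<wx = subst (P <_) (sym wx≡1+m) (s≤s P≤m)
    module T = Transposition w x m P≤x P≤m (<⇒≢ x<m) (<-trans x<m m<n) m<n
      (s≤s (proj₁ (head-≤2 head))) (s≤s (proj₂ (head-≤2 head))) prefix P<wx (large m P≤m m<n)

    head′ : Head T.w′
    head′ = head-swap T.at-0 T.at-1 head

    prefix′ : ∀ y → 2 ≤ y → y < P → at T.w′ y ≡ suc y
    prefix′ y 2≤y y<P = trans (T.at-prefix y 2≤y y<P) (prefix y 2≤y y<P)

    suffix′ : ∀ y → m ≤ y → y < n → at T.w′ y ≡ suc y
    suffix′ y m≤y y<n with y ≟ m
    ... | yes refl = trans T.at-q wx≡1+m
    ... | no y≢m   = trans (T.at-far y<n (≤-trans P≤m m≤y) (>⇒≢ (<-≤-trans x<m m≤y)) y≢m)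
                           (suffix y (≤∧≢⇒< m≤y (≢-sym y≢m)) y<n)

    onto′ : ∀ v → v < n → ∃[ y ] y < n × at T.w′ y ≡ suc v
    onto′ v v<n with onto v v<n
    ... | y , y<n , wy≡1+v with T.preimage y y<n
    ...   | y′ , y′<n , w′y′≡wy = y′ , y′<n , trans w′y′≡wy wy≡1+v

    large′ : ∀ y → P ≤ y → y < n → P < at T.w′ y
    large′ y P≤y y<n with y ≟ x | y ≟ m
    ... | yes refl | _        = subst (P <_) (sym T.at-p) (large m P≤m m<n)
    ... | no _     | yes refl = subst (P <_) (sym T.at-q) P<wx
    ... | no y≢x   | no y≢m   = subst (P <_) (sym (T.at-far y<n P≤y y≢x y≢m)) (large y P≤y y<n)

  goal-prepend : ∀ {w w′} → ReplaceSteps (2 + L) 4 w w′ → Goal w′ → Goal w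
  goal-prepend steps = Sum.map (evenReach-prepend steps) (evenReach-prepend steps)

  sort-step : ∀ {m w} → P ≤ m → m < n → Invariant (suc m) w → (∀ {w′} → Invariant m w′ → Goal w′) → Goal w
  sort-step {m} {w} P≤m m<n inv sorted with Invariant.onto inv m m<n
  ... | x , x<n , wx≡1+m with letter-position inv P≤m x<n wx≡1+m
  ...   | P≤x , x≤m with x ≟ m
  ...     | yes refl = sorted (invariant-shrink inv wx≡1+m)
  ...     | no x≢m   = continue (invariant-transpose inv P≤x (≤∧≢⇒< x≤m x≢m) m<n wx≡1+m)
    where
    continue : ∃[ w′ ] ReplaceSteps (2 + L) 4 w w′ × Invariant m w′ → Goal w
    continue (_ , steps , inv′) = goal-prepend steps (sorted inv′)

  sort : ∀ m {w} → P ≤ m → m ≤ n → Invariant m w → Goal w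
  sort zero    ()    _     _
  sort (suc m) P≤1+m 1+m≤n inv with m≤n⇒m<n∨m≡n P≤1+m
  ... | inj₂ refl      = goal-of-sorted inv
  ... | inj₁ (s≤s P≤m) = sort-step P≤m 1+m≤n inv (λ inv′ → sort m P≤m (<⇒≤ 1+m≤n) inv′)

  invariant-start : ∀ {a} → IsPerm a → (∀ x → x < P → at a x ≡ suc x) → Invariant n a
  invariant-start {a} a-perm a-prefix = record
    { head   = inj₁ (a-prefix 0 (s≤s z≤n) , a-prefix 1 (s≤s (s≤s z≤n)))
    ; prefix = λ x _ → a-prefix x
    ; suffix = λ x n≤x x<n → contradiction x<n (≤⇒≯ n≤x)
    ; onto   = letter-occurs a-perm
    ; large  = large
    }
    where
    large : ∀ x → P ≤ x → x < n → P < at a x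
    large x P≤x x<n with letter-form a-perm x<n
    ... | v , v<n , ax≡1+v with v <? P
    ...   | yes v<P = contradiction (at-injective a-perm v<n x<n (trans (a-prefix v v<P) (sym ax≡1+v)))
                                    (<⇒≢ (<-≤-trans v<P P≤x))
    ...   | no v≮P  = subst (P <_) (sym ax≡1+v) (s≤s (≮⇒≥ v≮P))

2k∸2≡2+L+L : ∀ L → 2 * (2 + L) ∸ 2 ≡ 2 + L + L
2k∸2≡2+L+L = solve 1 (λ L → L :+ (con 2 :+ (L :+ con 0)) := con 2 :+ L :+ L) refl
  where open +-*-Solver

2+L+L≤bound : ∀ L → 2 + L + L ≤ 3 * ((2 + L) * (2 + L)) + 3 ∸ 4 * (2 + L)
2+L+L≤bound L = m+n≤o⇒m≤o∸n (2 + L + L)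
  (subst (2 + L + L + 4 * (2 + L) ≤_) (sym (expand L)) (m≤m+n _ _))
  where
  open +-*-Solver
  expand : ∀ L → 3 * ((2 + L) * (2 + L)) + 3 ≡ (2 + L + L + 4 * (2 + L)) + (3 * (L * L) + 6 * L + 5)
  expand = solve 1 (λ L → con 3 :* ((con 2 :+ L) :* (con 2 :+ L)) :+ con 3
                          := (con 2 :+ L :+ L :+ con 4 :* (con 2 :+ L)) :+ (con 3 :* (L :* L) :+ con 6 :* L :+ con 5))
                   refl

lemma2p5 : (k n : ℕ) → 3 ≤ k → (3 * (k * k) + 3) ∸ (4 * k) ≤ n →
    (a : Word n) → IsPerm a →
    (∀ (i : Fin n) → toℕ i < 2 * k ∸ 2 → lookup a i ≡ suc (toℕ i)) →
    EvenReach k a (idWord n) ⊎ EvenReach k a (word2134 n)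
lemma2p5 (suc (suc L)) n (s≤s (s≤s _)) bound a a-perm a-prefix =
  sort n P≤n ≤-refl (invariant-start a-perm prefix)
  where
  open Sorting {n} L
  open Gadget {n} L using (P)
  P≤n : P ≤ n
  P≤n = ≤-trans (2+L+L≤bound L) bound
  prefix : ∀ x → x < P → at a x ≡ suc x
  prefix x x<P = begin
    at a x                   ≡⟨ at-fromℕ< a x<n ⟩
    lookup a (fromℕ< x<n)    ≡⟨ a-prefix (fromℕ< x<n) (subst₂ _<_ (sym (toℕ-fromℕ< x<n)) (sym (2k∸2≡2+L+L L)) x<P) ⟩
    suc (toℕ (fromℕ< x<n))   ≡⟨ cong suc (toℕ-fromℕ< x<n) ⟩
    suc x                    ∎
    where
    open ≡-Reasoning
    x<n : x < n
    x<n = <-≤-trans x<P P≤n
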